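{- Let $p$ be a prime and $\alpha$ a positive integer, and put $n=2^{\alpha}p$. Then $n$ is a Zumkeller number if and only if $\sigma(n)\geq 2n$.
   Context: $\sigma(n)$ denotes the sum of the positive divisors of $n$. A positive integer $n$ is a Zumkeller number if the set of its positive divisors can be partitioned into two disjoint subsets with equal sums. -}

module Defs where

open import Data.Nat using (ℕ; suc)
open import Data.Nat.Divisibility using (_∣?_)
open import Data.List using (List; filter; upTo; map)
open import Data.Nat.ListAction using (sum)
open import Data.List.Relation.Ternary.Interleaving.Propositional using (Interleaving)
open import Data.Product using (∃₂; _×_)
open import Relation.Binary.PropositionalEquality using (_≡_)

divisors : ℕ → List ℕ
divisors n = filter (_∣? n) (map suc (upTo n))

σ : ℕ → ℕ
σ n = sum (divisors n)

-- n is Zumkeller if its set of positive divisors can be partitioned into two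
-- disjoint subsets with equal sums: the (duplicate-free) divisor list is an
-- interleaving (split into two complementary sublists) A, B with equal sums.
Zumkeller : ℕ → Set
Zumkeller n = ∃₂ λ (A B : List ℕ) → Interleaving A B (divisors n) × sum A ≡ sum B

module Submission where

-- Let n = 2^α·p with p prime, T = 2^α and s = σ(T) = 2T − 1.
--
-- (⇒) holds for every n > 0: n is a divisor of itself, so the half of a
--     Zumkeller partition containing n sums to at least n, and so does the
--     other half; hence σ(n) ≥ 2n.
-- (⇐) For p = 2, n = 2^(α+1) has σ(n) = 2n − 1 < 2n, so there is nothing to
--     show.  For p odd the divisors of n are 2^i and 2^i·p (i ≤ α), hence
--     σ(n) = s·(p + 1).  Writing p + 1 = 2h, the hypothesis σ(n) ≥ 2n means
--     p ≤ s, i.e. h ≤ T, so k = T − h < T and σ(n)/2 = s·h = n + k.  Writing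
--     k in binary, k is a sum of distinct divisors 2^i < T, and together with
--     n these divisors form a set with sum exactly σ(n)/2.  Any such set of
--     divisors is one half of a Zumkeller partition.

open import Defs
open import Data.Nat
open import Data.Nat.Properties
open import Data.Nat.Divisibility
open import Data.Nat.Coprimality using (Coprime; coprime-divisor)
open import Data.Nat.Primality
  using (Prime; prime; prime[2]; prime⇒irreducible; prime⇒nonZero; euclidsLemma; irreducible[2])
open import Data.Nat.Tactic.RingSolver using (solve-∀)
open import Data.Nat.ListAction using (sum)
open import Data.Nat.ListAction.Properties using (sum-↭; sum-++)
open import Data.List using (List; []; _∷_; _++_; filter; map; upTo; applyDownFrom)
open import Data.List.Membership.Propositional using (_∈_)
open import Data.List.Membership.Propositional.Properties
  using (∈-filter⁺; ∈-filter⁻; ∈-map⁺; ∈-map⁻; ∈-++⁺ˡ; ∈-++⁺ʳ; ∈-++⁻; ∈-applyDownFrom⁺; ∈-applyDownFrom⁻; ∈-upTo⁺)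
open import Data.List.Membership.Propositional.Properties.WithK using (unique∧set⇒bag)
open import Data.List.Membership.DecPropositional _≟_ using (_∈?_)
open import Data.List.Relation.Unary.Any using (here; there)
import Data.List.Relation.Unary.All as All
open import Data.List.Relation.Unary.AllPairs using ([]; _∷_)
open import Data.List.Relation.Unary.Unique.Propositional using (Unique)
import Data.List.Relation.Unary.Unique.Propositional.Properties as Unique
open import Data.List.Relation.Binary.Permutation.Propositional using (_↭_)
open import Data.List.Relation.Binary.Permutation.Propositional.Properties using (∈-resp-↭)
open import Data.List.Relation.Binary.BagAndSetEquality using (∼bag⇒↭)
open import Data.List.Relation.Ternary.Interleaving.Propositional using (Interleaving; toPermutation)
open import Data.List.Relation.Ternary.Interleaving.Propositional.Properties using (filter⁺)
open import Data.Empty using (⊥-elim)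
open import Data.Sum using (_⊎_; inj₁; inj₂)
open import Data.Product using (∃; _×_; _,_; proj₁; proj₂)
open import Function using (_∘_)
open import Function.Bundles using (_⇔_; mk⇔)
open import Relation.Nullary using (¬_; yes; no; ¬?)
open import Relation.Binary.PropositionalEquality

same-members⇒↭ : {xs ys : List ℕ} → Unique xs → Unique ys →
                 (∀ {x} → x ∈ xs → x ∈ ys) → (∀ {x} → x ∈ ys → x ∈ xs) → xs ↭ ys
same-members⇒↭ uxs uys xs⊆ys ys⊆xs = ∼bag⇒↭ (unique∧set⇒bag uxs uys (mk⇔ xs⊆ys ys⊆xs))

sum-interleaving : {A B L : List ℕ} → Interleaving A B L → sum L ≡ sum A + sum B
sum-interleaving {A} {B} I = trans (sum-↭ (toPermutation I)) (sum-++ A B)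

∈-interleaving : {A B L : List ℕ} {x : ℕ} → Interleaving A B L → x ∈ L → x ∈ A ⊎ x ∈ B
∈-interleaving {A} I x∈L = ∈-++⁻ A (∈-resp-↭ (toPermutation I) x∈L)

∈⇒≤sum : {x : ℕ} (L : List ℕ) → x ∈ L → x ≤ sum L
∈⇒≤sum (y ∷ L) (here refl) = m≤m+n y (sum L)
∈⇒≤sum (y ∷ L) (there x∈L) = ≤-trans (∈⇒≤sum L x∈L) (m≤n+m (sum L) y)

sum-map-* : (p : ℕ) (xs : List ℕ) → sum (map (_* p) xs) ≡ sum xs * p
sum-map-* p []       = refl
sum-map-* p (x ∷ xs) = trans (cong (x * p +_) (sum-map-* p xs)) (sym (*-distribʳ-+ p x (sum xs)))

∈-divisors⁻ : {n d : ℕ} → d ∈ divisors n → d ∣ n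
∈-divisors⁻ {n} d∈ = proj₂ (∈-filter⁻ (_∣? n) {xs = map suc (upTo n)} d∈)

∈-divisors⁺ : {n d : ℕ} .{{_ : NonZero n}} → d ∣ n → d ∈ divisors n
∈-divisors⁺ {n} {zero}  0∣n = ⊥-elim (≢-nonZero⁻¹ n (0∣⇒≡0 0∣n))
∈-divisors⁺ {n} {suc d} d∣n = ∈-filter⁺ (_∣? n) (∈-map⁺ suc (∈-upTo⁺ (∣⇒≤ d∣n))) d∣n

divisors-unique : (n : ℕ) → Unique (divisors n)
divisors-unique n = Unique.filter⁺ (_∣? n) (Unique.map⁺ suc-injective (Unique.upTo⁺ n))

σ≡sum : {n : ℕ} .{{_ : NonZero n}} {D : List ℕ} → Unique D →
        (∀ {d} → d ∈ D → d ∣ n) → (∀ {d} → d ∣ n → d ∈ D) → σ n ≡ sum D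
σ≡sum {n} uD D∣n ∣n⇒D = sum-↭ (same-members⇒↭ (divisors-unique n) uD
                                   (∣n⇒D ∘ ∈-divisors⁻) (∈-divisors⁺ ∘ D∣n))

zumkeller⇒σ≥2n : {n : ℕ} .{{_ : NonZero n}} → Zumkeller n → σ n ≥ 2 * n
zumkeller⇒σ≥2n {n} (A , B , I , sumA≡sumB) = begin
    2 * n          ≡⟨ cong (n +_) (+-identityʳ n) ⟩
    n + n          ≤⟨ +-mono-≤ (proj₁ n≤halves) (proj₂ n≤halves) ⟩
    sum A + sum B  ≡⟨ sum-interleaving I ⟨
    σ n            ∎
  where
  open ≤-Reasoning
  n≤halves : n ≤ sum A × n ≤ sum B
  n≤halves with ∈-interleaving I (∈-divisors⁺ ∣-refl)
  ... | inj₁ n∈A = ∈⇒≤sum A n∈A , subst (n ≤_) sumA≡sumB (∈⇒≤sum A n∈A)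
  ... | inj₂ n∈B = subst (n ≤_) (sym sumA≡sumB) (∈⇒≤sum B n∈B) , ∈⇒≤sum B n∈B

half-subset⇒zumkeller : {n : ℕ} .{{_ : NonZero n}} {S : List ℕ} → Unique S →
                        (∀ {d} → d ∈ S → d ∣ n) → 2 * sum S ≡ σ n → Zumkeller n
half-subset⇒zumkeller {n} {S} uS S∣n half = A , B , filter⁺ (_∈? S) (divisors n) , sumA≡sumB
  where
  A B : List ℕ
  A = filter (_∈? S) (divisors n)
  B = filter (¬? ∘ (_∈? S)) (divisors n)
  A↭S : A ↭ S
  A↭S = same-members⇒↭ (Unique.filter⁺ (_∈? S) (divisors-unique n)) uS
          (λ d∈A → proj₂ (∈-filter⁻ (_∈? S) {xs = divisors n} d∈A))
          (λ d∈S → ∈-filter⁺ (_∈? S) (∈-divisors⁺ (S∣n d∈S)) d∈S)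
  sumA≡sumB : sum A ≡ sum B
  sumA≡sumB = sym (+-cancelˡ-≡ (sum A) (sum B) (sum A) (begin
    sum A + sum B  ≡⟨ sum-interleaving (filter⁺ (_∈? S) (divisors n)) ⟨
    σ n            ≡⟨ half ⟨
    2 * sum S      ≡⟨ cong (sum S +_) (+-identityʳ (sum S)) ⟩
    sum S + sum S  ≡⟨ cong₂ _+_ (sum-↭ A↭S) (sum-↭ A↭S) ⟨
    sum A + sum A  ∎))
    where open ≡-Reasoning

prime>1 : {p : ℕ} → Prime p → 1 < p
prime>1 {p} (prime {{p-nontrivial}} _) = nonTrivial⇒n>1 p {{p-nontrivial}}

∤⇒coprime : {p d : ℕ} → Prime p → ¬ p ∣ d → Coprime d p
∤⇒coprime pp p∤d (c∣d , c∣p) with prime⇒irreducible pp c∣p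
... | inj₁ c≡1 = c≡1
... | inj₂ refl = ⊥-elim (p∤d c∣d)

divisor-of-*prime : {p : ℕ} → Prime p → {m d : ℕ} → d ∣ m * p →
                    d ∣ m ⊎ ∃ λ e → e ∣ m × d ≡ e * p
divisor-of-*prime {p} pp {m} {d} d∣mp with p ∣? d
... | yes (divides e refl) = inj₂ (e , *-cancelʳ-∣ p {{prime⇒nonZero pp}} d∣mp , refl)
... | no p∤d = inj₁ (coprime-divisor (∤⇒coprime pp p∤d) (subst (d ∣_) (*-comm m p) d∣mp))

prime-power-divisor : {q : ℕ} → Prime q → (a : ℕ) {d : ℕ} → d ∣ q ^ a →
                      ∃ λ i → i ≤ a × d ≡ q ^ i
prime-power-divisor qq zero d∣1 = 0 , z≤n , ∣1⇒≡1 d∣1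
prime-power-divisor {q} qq (suc a) {d} d∣ with divisor-of-*prime qq (subst (d ∣_) (*-comm q (q ^ a)) d∣)
... | inj₁ d∣q^a with prime-power-divisor qq a d∣q^a
...   | i , i≤a , d≡q^i = i , m≤n⇒m≤1+n i≤a , d≡q^i
prime-power-divisor {q} qq (suc a) d∣ | inj₂ (e , e∣q^a , refl) with prime-power-divisor qq a e∣q^a
...   | i , i≤a , refl = suc i , s≤s i≤a , *-comm (q ^ i) q

^-monoʳ-∣ : (m : ℕ) {i a : ℕ} → i ≤ a → m ^ i ∣ m ^ a
^-monoʳ-∣ m {a = a} z≤n = 1∣ (m ^ a)
^-monoʳ-∣ m (s≤s i≤a) = *-monoʳ-∣ m (^-monoʳ-∣ m i≤a)

odd-prime∤2^ : {p : ℕ} → Prime p → p ≢ 2 → (i : ℕ) → ¬ p ∣ 2 ^ i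
odd-prime∤2^ pp p≢2 zero p∣1 = <⇒≢ (prime>1 pp) (sym (∣1⇒≡1 p∣1))
odd-prime∤2^ pp p≢2 (suc i) p∣ with euclidsLemma 2 (2 ^ i) pp p∣
... | inj₂ p∣2^i = odd-prime∤2^ pp p≢2 i p∣2^i
... | inj₁ p∣2 with irreducible[2] p∣2
...   | inj₁ p≡1 = <⇒≢ (prime>1 pp) (sym p≡1)
...   | inj₂ p≡2 = p≢2 p≡2

odd⇒2∣suc : (n : ℕ) → ¬ 2 ∣ n → 2 ∣ suc n
odd⇒2∣suc zero          2∤0 = ⊥-elim (2∤0 (2 ∣0))
odd⇒2∣suc (suc zero)    _   = ∣-refl
odd⇒2∣suc (suc (suc n)) 2∤n+2 = ∣m∣n⇒∣m+n ∣-refl (odd⇒2∣suc n (2∤n+2 ∘ ∣m∣n⇒∣m+n ∣-refl))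

pow2s : ℕ → List ℕ
pow2s = applyDownFrom (2 ^_)

∈-pow2s⇒< : {a x : ℕ} → x ∈ pow2s a → x < 2 ^ a
∈-pow2s⇒< x∈ with ∈-applyDownFrom⁻ (2 ^_) x∈
... | i , i<a , refl = ^-monoʳ-< 2 (s≤s (s≤s z≤n)) i<a

pow2s-unique : (a : ℕ) → Unique (pow2s a)
pow2s-unique a = Unique.applyDownFrom⁺₁ (2 ^_) a
                   (λ j<i _ → >⇒≢ (^-monoʳ-< 2 (s≤s (s≤s z≤n)) j<i))

sum-pow2s : (a : ℕ) → suc (sum (pow2s a)) ≡ 2 ^ a
sum-pow2s zero    = refl
sum-pow2s (suc a) = begin
  suc (2 ^ a + sum (pow2s a))  ≡⟨ +-suc (2 ^ a) (sum (pow2s a)) ⟨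
  2 ^ a + suc (sum (pow2s a))  ≡⟨ cong (2 ^ a +_) (trans (sum-pow2s a) (sym (+-identityʳ (2 ^ a)))) ⟩
  2 ^ a + (2 ^ a + 0)          ∎
  where open ≡-Reasoning

binary-expansion : (a m : ℕ) → m < 2 ^ a →
                   ∃ λ S → Unique S × (∀ {x} → x ∈ S → x ∈ pow2s a) × sum S ≡ m
binary-expansion zero    zero    _ = [] , [] , (λ ()) , refl
binary-expansion zero    (suc m) (s≤s ())
binary-expansion (suc a) m m<2^a+1 with m <? 2 ^ a
... | yes m<2^a with binary-expansion a m m<2^a
...   | S , uS , S⊆ , ΣS≡m = S , uS , there ∘ S⊆ , ΣS≡m
binary-expansion (suc a) m m<2^a+1 | no m≮2^a
    with binary-expansion a (m ∸ 2 ^ a)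
           (m<n+o⇒m∸n<o m (2 ^ a) {{m^n≢0 2 a}} (subst (m <_) (cong (2 ^ a +_) (+-identityʳ (2 ^ a))) m<2^a+1))
... | S , uS , S⊆ , ΣS≡m∸2^a =
      2 ^ a ∷ S , All.tabulate (>⇒≢ ∘ ∈-pow2s⇒< ∘ S⊆) ∷ uS , S'⊆ , ΣS'≡m
  where
  S'⊆ : ∀ {x} → x ∈ 2 ^ a ∷ S → x ∈ pow2s (suc a)
  S'⊆ (here refl) = here refl
  S'⊆ (there x∈S) = there (S⊆ x∈S)
  ΣS'≡m : 2 ^ a + sum S ≡ m
  ΣS'≡m = trans (cong (2 ^ a +_) ΣS≡m∸2^a) (trans (+-comm (2 ^ a) _) (m∸n+n≡m (≮⇒≥ m≮2^a)))

σ-2^ : (a : ℕ) → σ (2 ^ a) ≡ sum (pow2s (suc a))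
σ-2^ a = σ≡sum {{m^n≢0 2 a}} (pow2s-unique (suc a)) pow2s∣ ∣⇒pow2s
  where
  pow2s∣ : ∀ {d} → d ∈ pow2s (suc a) → d ∣ 2 ^ a
  pow2s∣ d∈ with ∈-applyDownFrom⁻ (2 ^_) d∈
  ... | i , i<a+1 , refl = ^-monoʳ-∣ 2 (≤-pred i<a+1)
  ∣⇒pow2s : ∀ {d} → d ∣ 2 ^ a → d ∈ pow2s (suc a)
  ∣⇒pow2s d∣ with prime-power-divisor prime[2] a d∣
  ... | i , i≤a , refl = ∈-applyDownFrom⁺ (2 ^_) (s≤s i≤a)

suc-σ-2^ : (a : ℕ) → suc (σ (2 ^ a)) ≡ 2 * 2 ^ a
suc-σ-2^ a = trans (cong suc (σ-2^ a)) (sum-pow2s (suc a))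

σ-2^*p : {p : ℕ} → Prime p → p ≢ 2 → (a : ℕ) → σ (2 ^ a * p) ≡ σ (2 ^ a) * suc p
σ-2^*p {p} pp p≢2 a = begin
  σ (2 ^ a * p)             ≡⟨ σ≡sum {{n≢0}} uD D∣ ∣⇒D ⟩
  sum (P ++ map (_* p) P)   ≡⟨ sum-++ P (map (_* p) P) ⟩
  sum P + sum (map (_* p) P) ≡⟨ cong (sum P +_) (sum-map-* p P) ⟩
  sum P + sum P * p         ≡⟨ *-suc (sum P) p ⟨
  sum P * suc p             ≡⟨ cong (_* suc p) (σ-2^ a) ⟨
  σ (2 ^ a) * suc p         ∎
  where
  open ≡-Reasoning
  instance
    p≢0 : NonZero p
    p≢0 = prime⇒nonZero pp
    n≢0 : NonZero (2 ^ a * p)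
    n≢0 = m*n≢0 (2 ^ a) p {{m^n≢0 2 a}}
  P : List ℕ
  P = pow2s (suc a)
  -- 2^i = 2^j·p would make p a divisor of a power of two.
  disjoint : ∀ {d} → ¬ (d ∈ P × d ∈ map (_* p) P)
  disjoint (d∈P , d∈Pp) with ∈-applyDownFrom⁻ (2 ^_) d∈P | ∈-map⁻ (_* p) {xs = P} d∈Pp
  ... | i , _ , refl | e , e∈P , 2^i≡ep with ∈-applyDownFrom⁻ (2 ^_) e∈P
  ...   | j , _ , refl = odd-prime∤2^ pp p≢2 i (divides (2 ^ j) 2^i≡ep)
  uD : Unique (P ++ map (_* p) P)
  uD = Unique.++⁺ (pow2s-unique (suc a))
                  (Unique.map⁺ (λ {x} {y} → *-cancelʳ-≡ x y p) (pow2s-unique (suc a))) disjoint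
  D∣ : ∀ {d} → d ∈ P ++ map (_* p) P → d ∣ 2 ^ a * p
  D∣ d∈ with ∈-++⁻ P d∈
  ... | inj₁ d∈P with ∈-applyDownFrom⁻ (2 ^_) d∈P
  ...   | i , i<a+1 , refl = ∣-trans (^-monoʳ-∣ 2 {a = a} (≤-pred i<a+1)) (m∣m*n p)
  D∣ d∈ | inj₂ d∈Pp with ∈-map⁻ (_* p) {xs = P} d∈Pp
  ...   | e , e∈P , refl with ∈-applyDownFrom⁻ (2 ^_) e∈P
  ...     | i , i<a+1 , refl = *-monoˡ-∣ p (^-monoʳ-∣ 2 {a = a} (≤-pred i<a+1))
  ∣⇒D : ∀ {d} → d ∣ 2 ^ a * p → d ∈ P ++ map (_* p) P
  ∣⇒D d∣ with divisor-of-*prime pp d∣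
  ... | inj₁ d∣2^a with prime-power-divisor prime[2] a d∣2^a
  ...   | i , i≤a , refl = ∈-++⁺ˡ (∈-applyDownFrom⁺ (2 ^_) (s≤s i≤a))
  ∣⇒D d∣ | inj₂ (e , e∣2^a , refl) with prime-power-divisor prime[2] a e∣2^a
  ...   | i , i≤a , refl = ∈-++⁺ʳ P (∈-map⁺ (_* p) (∈-applyDownFrom⁺ (2 ^_) (s≤s i≤a)))

abundance⇒p≤s : (s T p : ℕ) → suc s ≡ 2 * T → 2 * (T * p) ≤ s * suc p → p ≤ s
abundance⇒p≤s s T p s+1≡2T le = +-cancelʳ-≤ (s * p) p s (begin
  p + s * p      ≡⟨ cong (_* p) s+1≡2T ⟩
  2 * T * p      ≡⟨ *-assoc 2 T p ⟩
  2 * (T * p)    ≤⟨ le ⟩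
  s * suc p      ≡⟨ *-suc s p ⟩
  s + s * p      ∎)
  where open ≤-Reasoning

half-of-σ : (s T p h k : ℕ) → suc s ≡ 2 * T → suc p ≡ h * 2 → k + h ≡ T →
            2 * (T * p + k) ≡ s * suc p
half-of-σ s T p h k s+1≡2T p+1≡2h k+h≡T = begin
  2 * (T * p + k)  ≡⟨ cong (2 *_) Tp+k≡sh ⟩
  2 * (s * h)      ≡⟨ double-comm s h ⟩
  s * (h * 2)      ≡⟨ cong (s *_) p+1≡2h ⟨
  s * suc p        ∎
  where
  open ≡-Reasoning
  double-comm : ∀ s h → 2 * (s * h) ≡ s * (h * 2)
  double-comm = solve-∀
  double-assoc : ∀ T h → T * (h * 2) ≡ 2 * T * h
  double-assoc = solve-∀
  Tp+k≡sh : T * p + k ≡ s * h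
  Tp+k≡sh = +-cancelʳ-≡ h (T * p + k) (s * h) (begin
    T * p + k + h    ≡⟨ +-assoc (T * p) k h ⟩
    T * p + (k + h)  ≡⟨ cong (T * p +_) k+h≡T ⟩
    T * p + T        ≡⟨ +-comm (T * p) T ⟩
    T + T * p        ≡⟨ *-suc T p ⟨
    T * suc p        ≡⟨ cong (T *_) p+1≡2h ⟩
    T * (h * 2)      ≡⟨ double-assoc T h ⟩
    2 * T * h        ≡⟨ cong (_* h) s+1≡2T ⟨
    suc s * h        ≡⟨ +-comm h (s * h) ⟩
    s * h + h        ∎)

odd-prime⇒2∣suc : {p : ℕ} → Prime p → p ≢ 2 → 2 ∣ suc p
odd-prime⇒2∣suc {p} pp p≢2 = odd⇒2∣suc p 2∤p
  where
  2∤p : ¬ 2 ∣ p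
  2∤p 2∣p with prime⇒irreducible pp 2∣p
  ... | inj₁ ()
  ... | inj₂ 2≡p = p≢2 (sym 2≡p)

-- For an odd prime p and n = 2^α·p with σ(n) ≥ 2n, half of σ(n) exceeds n by
-- some k < 2^α (namely k = 2^α − (p + 1)/2).
abundant⇒half-of-σ : {p : ℕ} → Prime p → p ≢ 2 → (α : ℕ) →
                     σ (2 ^ α * p) ≥ 2 * (2 ^ α * p) →
                     ∃ λ k → k < 2 ^ α × 2 * (2 ^ α * p + k) ≡ σ (2 ^ α * p)
abundant⇒half-of-σ {p} pp p≢2 α abundant =
  k , k<T , trans (half-of-σ s T p h k s+1≡2T p+1≡2h k+h≡T) (sym σn≡s[p+1])
  where
  T s h k : ℕ
  T = 2 ^ α
  s = σ T
  h = quotient (odd-prime⇒2∣suc pp p≢2)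
  k = T ∸ h
  s+1≡2T : suc s ≡ 2 * T
  s+1≡2T = suc-σ-2^ α
  p+1≡2h : suc p ≡ h * 2
  p+1≡2h = _∣_.equality (odd-prime⇒2∣suc pp p≢2)
  σn≡s[p+1] : σ (T * p) ≡ s * suc p
  σn≡s[p+1] = σ-2^*p pp p≢2 α
  h≤T : h ≤ T
  h≤T = *-cancelʳ-≤ h T 2 (begin
    h * 2   ≡⟨ p+1≡2h ⟨
    suc p   ≤⟨ s≤s (abundance⇒p≤s s T p s+1≡2T (subst (2 * (T * p) ≤_) σn≡s[p+1] abundant)) ⟩
    suc s   ≡⟨ s+1≡2T ⟩
    2 * T   ≡⟨ *-comm 2 T ⟩
    T * 2   ∎)
    where open ≤-Reasoning
  k+h≡T : k + h ≡ T
  k+h≡T = m∸n+n≡m h≤T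
  k<T : k < T
  k<T = subst (k <_) k+h≡T (m<m+n k (*-cancelʳ-< 2 0 h (subst (0 <_) p+1≡2h z<s)))

-- The converse for odd primes: n together with the binary expansion of k is a
-- set of distinct divisors with sum σ(n)/2.
σ≥2n⇒zumkeller : {p : ℕ} → Prime p → p ≢ 2 → (α : ℕ) →
                 σ (2 ^ α * p) ≥ 2 * (2 ^ α * p) → Zumkeller (2 ^ α * p)
σ≥2n⇒zumkeller {p} pp p≢2 α abundant
  with k , k<2^α , 2[n+k]≡σn ← abundant⇒half-of-σ pp p≢2 α abundant
  with S , uS , S⊆pow2s , ΣS≡k ← binary-expansion α k k<2^α
  = half-subset⇒zumkeller {{n≢0}} (n∉S ∷ uS) S'∣n (trans (cong (λ m → 2 * (n + m)) ΣS≡k) 2[n+k]≡σn)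
  where
  instance
    p≢0 : NonZero p
    p≢0 = prime⇒nonZero pp
  n : ℕ
  n = 2 ^ α * p
  n≢0 : NonZero n
  n≢0 = m*n≢0 (2 ^ α) p {{m^n≢0 2 α}}
  -- Every element of S is below 2^α ≤ n.
  n∉S : All.All (n ≢_) S
  n∉S = All.tabulate (λ x∈S → >⇒≢ (<-≤-trans (∈-pow2s⇒< (S⊆pow2s x∈S)) (m≤m*n (2 ^ α) p)))
  S'∣n : ∀ {d} → d ∈ n ∷ S → d ∣ n
  S'∣n (here refl) = ∣-refl
  S'∣n (there d∈S) with ∈-applyDownFrom⁻ (2 ^_) (S⊆pow2s d∈S)
  ... | i , i<α , refl = ∣-trans (^-monoʳ-∣ 2 (<⇒≤ i<α)) (m∣m*n p)

mainTheorem3 : (p α : ℕ) → Prime p → α > 0 →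
               Zumkeller (2 ^ α * p) ⇔ σ (2 ^ α * p) ≥ 2 * (2 ^ α * p)
mainTheorem3 p α pp _ = mk⇔ (zumkeller⇒σ≥2n {{n≢0}}) converse
  where
  n≢0 : NonZero (2 ^ α * p)
  n≢0 = m*n≢0 (2 ^ α) p {{m^n≢0 2 α}} {{prime⇒nonZero pp}}
  -- For p = 2, n = 2^(α+1) is deficient, so only odd p needs a construction.
  converse : σ (2 ^ α * p) ≥ 2 * (2 ^ α * p) → Zumkeller (2 ^ α * p)
  converse abundant with p ≟ 2
  ... | no p≢2   = σ≥2n⇒zumkeller pp p≢2 α abundant
  ... | yes refl = ⊥-elim (<⇒≱ deficient abundant)
    where
    deficient : σ (2 ^ α * 2) < 2 * (2 ^ α * 2)
    deficient = subst (λ m → σ m < 2 * m) (*-comm 2 (2 ^ α)) (≤-reflexive (suc-σ-2^ (suc α)))
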